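{- Let $q\ge 5$ be a prime, $b=\frac{q-1}{2}$, $c\ge1$ an integer, and let $I$ be a set of $n_1$ non-negative integers each less than $b^{c+1}$. Let $\mathcal{P}=\bigcup_{m\in I}\mathcal{D}(m)$ be the set of all derived polynomials of the elements of $I$ (defined in the context), viewed in $\mathbb{F}_q[X]$. Then every $P\in\mathcal{P}$ appears as a multiple for at most $c\cdot 2^c\cdot n_1$ values $x\in\mathbb{F}_q$; i.e. there are at most $c\cdot2^c\cdot n_1$ elements $x\in\mathbb{F}_q$ for which some $Q\in\mathcal{P}$, $Q\neq P$, satisfies $Q(x)=P(x)$ in $\mathbb{F}_q$.
   Context: For an integer $m$ with $0\le m<b^{c+1}$ write $m=\sum_{k=0}^{c} m_k b^k$ in base $b$ with digits $0\le m_k\le b-1$. For each subset $S\subseteq\{0,\dots,c-1\}$ define $P_{m,S}(X)=\sum_{k=0}^{c}\big(m_k+b\,[k\in S]-[k-1\in S]\big)X^k$ (for each $k\in S$, add $b$ to the coefficient of $X^k$ and subtract $1$ from the coefficient of $X^{k+1}$), and $\mathcal{D}(m)=\{P_{m,S}:S\subseteq\{0,\dots,c-1\}\}$. For an assignment $x\in\mathbb{F}_q$, a polynomial $P\in\mathcal{P}$ is a singleton if no other polynomial of $\mathcal{P}$ takes the same value at $x$, and a multiple otherwise (each assignment yields one reduced vector of length $q$ whose positions are these values). -}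

module Defs where

open import Data.Nat using (ℕ; zero; suc; _∸_; _/_; _%_; _<_)
open import Data.Integer using (ℤ; +_; _-_) renaming (_+_ to _+ℤ_; _*_ to _*ℤ_; _^_ to _^ℤ_)
open import Data.Integer.Divisibility using () renaming (_∣_ to _∣ℤ_)
open import Data.Bool using (Bool; true; false)
open import Data.Vec using (Vec; []; _∷_)
open import Data.Fin using (Fin; toℕ)
open import Data.Fin.Subset using (Subset)
open import Data.List using (List)
open import Data.List.Membership.Propositional using (_∈_)
open import Data.Product using (Σ; _×_; ∃-syntax)
open import Relation.Nullary using (¬_)

half : ℕ → ℕ
half q = (q ∸ 1) / 2

-- k-th base-b digit of m (b ≥ 2 in the application; b = 0,1 give junk 0)
digit : ℕ → ℕ → ℕ → ℕ
digit zero m k = 0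
digit (suc b) m zero = m % suc b
digit (suc b) m (suc k) = digit (suc b) (m / suc b) k

inS : ∀ {c} → Subset c → ℕ → Bool
inS [] _ = false
inS (x ∷ s) zero = x
inS (x ∷ s) (suc k) = inS s k

prevInS : ∀ {c} → Subset c → ℕ → Bool
prevInS S zero = false
prevInS S (suc k) = inS S k

iverson : Bool → ℤ
iverson true = + 1
iverson false = + 0

-- polynomials with integer coefficients, given by their coefficient function
-- (only indices 0..c are used: degree ≤ c)
Poly : Set
Poly = ℕ → ℤ

derived : (b : ℕ) → ∀ {c} → ℕ → Subset c → Poly
derived b m S k = (+ digit b m k +ℤ (+ b) *ℤ iverson (inS S k)) - iverson (prevInS S k)

sumTo : ℕ → (ℕ → ℤ) → ℤ
sumTo zero f = + 0
sumTo (suc n) f = sumTo n f +ℤ f n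

eval : ℕ → Poly → ℤ → ℤ
eval c P x = sumTo (suc c) (λ k → P k *ℤ (x ^ℤ k))

_≡[mod_]_ : ℤ → ℕ → ℤ → Set
a ≡[mod q ] a' = (+ q) ∣ℤ (a - a')

PolyEq : ℕ → ℕ → Poly → Poly → Set
PolyEq q c P Q = ∀ k → k < suc c → P k ≡[mod q ] Q k

IsMultiple : (q c : ℕ) → List ℕ → Poly → Fin q → Set
IsMultiple q c I P x =
  ∃[ m' ] Σ (Subset c) λ S' → (m' ∈ I × ¬ PolyEq q c (derived (half q) m' S') P
     × eval c (derived (half q) m' S') (+ toℕ x) ≡[mod q ] eval c P (+ toℕ x))

-- If P is a multiple at x, then x is a root in 𝔽_q of Q − P for some Q ∈ 𝒫 with Q ≠ P in
-- 𝔽_q[X]. Such a difference is a nonzero polynomial of degree ≤ c, so by the factor theorem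
-- and Euclid's lemma it has at most c roots in 𝔽_q. As 𝒫 is indexed by the at most 2^c n₁
-- pairs (m′, S′), at most c 2^c n₁ points x are left.
module Submission where

open import Defs
open import Data.Nat using (ℕ; zero; suc; _≤_; _<_; _⊔_; _*_; _^_; _+_; z≤n; s≤s; s≤s⁻¹; _≤?_)
import Data.Nat.Properties as ℕₚ
open import Data.Nat.Divisibility using (>⇒∤) renaming (_∣_ to _∣ℕ_)
open import Data.Nat.Primality using (Prime; euclidsLemma)
open import Data.Integer using (ℤ; +_; 0ℤ; 1ℤ; _-_; _⊖_; ∣_∣)
  renaming (_+_ to _+ℤ_; _*_ to _*ℤ_; _^_ to _^ℤ_)
import Data.Integer.Properties as ℤₚ
open import Data.Integer.Divisibility.Signed
  using (divides; ∣ᵤ⇒∣; ∣⇒∣ᵤ; _∣?_; ∣m+n∣n⇒∣m; ∣n⇒∣m*n; ∣m∣n⇒∣m-n) renaming (_∣_ to _∣ₛ_)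
open import Data.Integer.Tactic.RingSolver using (solve-∀)
open import Data.Fin using (Fin; toℕ)
open import Data.Fin.Properties using (toℕ<n; toℕ-injective)
open import Data.Fin.Subset using (Subset)
open import Data.Bool using (true; false)
open import Data.Vec using ([]; _∷_)
open import Data.List using (List; []; _∷_; length; map; _++_; filter; applyUpTo; cartesianProduct)
open import Data.List.Properties using (length-++; length-map; length-applyUpTo)
open import Data.List.Relation.Unary.All as All using (All; []; _∷_)
open import Data.List.Relation.Unary.All.Properties using (all-filter; filter⁺; applyUpTo⁻)
open import Data.List.Relation.Unary.Any using (Any; here; there)
open import Data.List.Relation.Unary.AllPairs using ([]; _∷_)
open import Data.List.Relation.Unary.Unique.Propositional using (Unique)
import Data.List.Relation.Unary.Unique.Propositional.Properties as Unique
open import Data.List.Membership.Propositional using (_∈_; lose)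
open import Data.List.Membership.Propositional.Properties using (∈-map⁺; ∈-++⁺ˡ; ∈-++⁺ʳ; ∈-cartesianProduct⁺)
open import Data.Product using (_×_; _,_)
open import Data.Sum using (inj₁; inj₂; _⊎_)
open import Data.Empty using (⊥-elim)
open import Function using (_∘_)
open import Relation.Nullary using (¬_; Dec; yes; no)
open import Relation.Nullary.Decidable using (decidable-stable; ¬¬-excluded-middle)
open import Relation.Unary using (Decidable)
open import Relation.Unary.Properties using (∁?)
open import Relation.Binary.PropositionalEquality

sumTo-cong : ∀ n {f g : ℕ → ℤ} → (∀ k → f k ≡ g k) → sumTo n f ≡ sumTo n g
sumTo-cong zero    f≗g = refl
sumTo-cong (suc n) f≗g = cong₂ _+ℤ_ (sumTo-cong n f≗g) (f≗g n)

sumTo-suc : ∀ n (f : ℕ → ℤ) → sumTo (suc n) f ≡ f 0 +ℤ sumTo n (f ∘ suc)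
sumTo-suc zero    f = trans (ℤₚ.+-identityˡ (f 0)) (sym (ℤₚ.+-identityʳ (f 0)))
sumTo-suc (suc n) f = trans (cong (_+ℤ f (suc n)) (sumTo-suc n f)) (ℤₚ.+-assoc (f 0) _ _)

sumTo-*ˡ : ∀ n x (f : ℕ → ℤ) → sumTo n (λ k → x *ℤ f k) ≡ x *ℤ sumTo n f
sumTo-*ˡ zero    x f = sym (ℤₚ.*-zeroʳ x)
sumTo-*ˡ (suc n) x f =
  trans (cong (_+ℤ x *ℤ f n) (sumTo-*ˡ n x f)) (sym (ℤₚ.*-distribˡ-+ x (sumTo n f) (f n)))

sumTo-- : ∀ n (f g : ℕ → ℤ) → sumTo n (λ k → f k - g k) ≡ sumTo n f - sumTo n g
sumTo-- zero    f g = refl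
sumTo-- (suc n) f g = trans (cong (_+ℤ (f n - g n)) (sumTo-- n f g))
                            (interchange (sumTo n f) (sumTo n g) (f n) (g n))
  where
  interchange : ∀ s t u v → (s - t) +ℤ (u - v) ≡ (s +ℤ u) - (t +ℤ v)
  interchange = solve-∀

horner : List ℤ → ℤ → ℤ
horner []      x = 0ℤ
horner (a ∷ p) x = a +ℤ x *ℤ horner p x

sumTo-horner : ∀ n (f : ℕ → ℤ) x → sumTo n (λ k → f k *ℤ x ^ℤ k) ≡ horner (applyUpTo f n) x
sumTo-horner zero    f x = refl
sumTo-horner (suc n) f x = begin
  sumTo (suc n) (λ k → f k *ℤ x ^ℤ k)                    ≡⟨ sumTo-suc n _ ⟩
  f 0 *ℤ 1ℤ +ℤ sumTo n (λ k → f (suc k) *ℤ (x *ℤ x ^ℤ k))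
    ≡⟨ cong₂ _+ℤ_ (ℤₚ.*-identityʳ (f 0)) (sumTo-cong n (λ k → swap (f (suc k)) x (x ^ℤ k))) ⟩
  f 0 +ℤ sumTo n (λ k → x *ℤ (f (suc k) *ℤ x ^ℤ k))      ≡⟨ cong (f 0 +ℤ_) (sumTo-*ˡ n x _) ⟩
  f 0 +ℤ x *ℤ sumTo n (λ k → f (suc k) *ℤ x ^ℤ k)
    ≡⟨ cong (λ s → f 0 +ℤ x *ℤ s) (sumTo-horner n (f ∘ suc) x) ⟩
  horner (applyUpTo f (suc n)) x                         ∎
  where
  open ≡-Reasoning
  swap : ∀ a x y → a *ℤ (x *ℤ y) ≡ x *ℤ (a *ℤ y)
  swap = solve-∀

eval-- : ∀ c (P Q : Poly) x → eval c P x - eval c Q x ≡ eval c (λ k → P k - Q k) x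
eval-- c P Q x = sym (trans (sumTo-cong (suc c) (λ k → distrib (P k) (Q k) (x ^ℤ k)))
                            (sumTo-- (suc c) (λ k → P k *ℤ x ^ℤ k) (λ k → Q k *ℤ x ^ℤ k)))
  where
  distrib : ∀ a b y → (a - b) *ℤ y ≡ a *ℤ y - b *ℤ y
  distrib = solve-∀

-- The quotient of c₀ ∷ p by X − a; it does not depend on c₀.
linearQuotient : ℤ → List ℤ → List ℤ
linearQuotient a []      = []
linearQuotient a (c ∷ p) = horner (c ∷ p) a ∷ linearQuotient a p

length-linearQuotient : ∀ a p → length (linearQuotient a p) ≡ length p
length-linearQuotient a []      = refl
length-linearQuotient a (c ∷ p) = cong suc (length-linearQuotient a p)

horner-linearQuotient : ∀ a c₀ p x →
  horner (c₀ ∷ p) x - horner (c₀ ∷ p) a ≡ (x - a) *ℤ horner (linearQuotient a p) x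
horner-linearQuotient a c₀ p x = trans (cancel c₀ x a (horner p x) (horner p a)) (shifted p)
  where
  cancel : ∀ c x a h h′ → (c +ℤ x *ℤ h) - (c +ℤ a *ℤ h′) ≡ x *ℤ h - a *ℤ h′
  cancel = solve-∀
  shifted : ∀ p → x *ℤ horner p x - a *ℤ horner p a ≡ (x - a) *ℤ horner (linearQuotient a p) x
  shifted []      = annihilate x a
    where
    annihilate : ∀ x a → x *ℤ 0ℤ - a *ℤ 0ℤ ≡ (x - a) *ℤ 0ℤ
    annihilate = solve-∀
  shifted (c ∷ p) = begin
    x *ℤ (c +ℤ x *ℤ horner p x) - a *ℤ (c +ℤ a *ℤ horner p a)
      ≡⟨ regroup c x a (horner p x) (horner p a) ⟩
    (x - a) *ℤ (c +ℤ a *ℤ horner p a) +ℤ x *ℤ (x *ℤ horner p x - a *ℤ horner p a)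
      ≡⟨ cong (λ d → (x - a) *ℤ (c +ℤ a *ℤ horner p a) +ℤ x *ℤ d) (shifted p) ⟩
    (x - a) *ℤ (c +ℤ a *ℤ horner p a) +ℤ x *ℤ ((x - a) *ℤ horner (linearQuotient a p) x)
      ≡⟨ factor (x - a) (c +ℤ a *ℤ horner p a) x (horner (linearQuotient a p) x) ⟩
    (x - a) *ℤ (c +ℤ a *ℤ horner p a +ℤ x *ℤ horner (linearQuotient a p) x) ∎
    where
    open ≡-Reasoning
    regroup : ∀ c x a h h′ →
      x *ℤ (c +ℤ x *ℤ h) - a *ℤ (c +ℤ a *ℤ h′) ≡ (x - a) *ℤ (c +ℤ a *ℤ h′) +ℤ x *ℤ (x *ℤ h - a *ℤ h′)
    regroup = solve-∀
    factor : ∀ d u x e → d *ℤ u +ℤ x *ℤ (d *ℤ e) ≡ d *ℤ (u +ℤ x *ℤ e)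
    factor = solve-∀

∣-linearQuotient⇒∣-coefficients : ∀ {d} a c₀ p → d ∣ₛ horner (c₀ ∷ p) a →
  All (d ∣ₛ_) (linearQuotient a p) → All (d ∣ₛ_) (c₀ ∷ p)
∣-linearQuotient⇒∣-coefficients a c₀ []      d∣p[a] []           =
  ∣m+n∣n⇒∣m d∣p[a] (∣n⇒∣m*n a (divides 0ℤ refl)) ∷ []
∣-linearQuotient⇒∣-coefficients a c₀ (c ∷ p) d∣p[a] (d∣h ∷ d∣qs) =
  ∣m+n∣n⇒∣m d∣p[a] (∣n⇒∣m*n a d∣h) ∷ ∣-linearQuotient⇒∣-coefficients a c p d∣h d∣qs

prime∣*⇒∣⊎∣ : ∀ {p} i j → Prime p → + p ∣ₛ i *ℤ j → + p ∣ₛ i ⊎ + p ∣ₛ j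
prime∣*⇒∣⊎∣ i j prime-p p∣ij
  with euclidsLemma ∣ i ∣ ∣ j ∣ prime-p (subst (_ ∣ℕ_) (ℤₚ.abs-* i j) (∣⇒∣ᵤ p∣ij))
... | inj₁ p∣i = inj₁ (∣ᵤ⇒∣ p∣i)
... | inj₂ p∣j = inj₂ (∣ᵤ⇒∣ p∣j)

∣toℕ-difference∣<n : ∀ {n} (x y : Fin n) → ∣ + toℕ y - + toℕ x ∣ < n
∣toℕ-difference∣<n x y = begin-strict
  ∣ + toℕ y - + toℕ x ∣     ≡⟨ cong ∣_∣ (ℤₚ.[+m]-[+n]≡m⊖n (toℕ y) (toℕ x)) ⟩
  ∣ toℕ y ⊖ toℕ x ∣         ≤⟨ ℤₚ.∣m⊝n∣≤m⊔n (toℕ y) (toℕ x) ⟩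
  toℕ y ⊔ toℕ x             <⟨ ℕₚ.⊔-lub (toℕ<n y) (toℕ<n x) ⟩
  _                         ∎
  where open ℕₚ.≤-Reasoning

≢⇒∤-toℕ-difference : ∀ {q} {x y : Fin q} → x ≢ y → ¬ (+ q ∣ₛ + toℕ y - + toℕ x)
≢⇒∤-toℕ-difference {q} {x} {y} x≢y q∣y-x with ∣ + toℕ y - + toℕ x ∣ in eq
... | zero  = x≢y (sym (toℕ-injective (ℤₚ.+-injective (ℤₚ.i-j≡0⇒i≡j _ _ (ℤₚ.∣i∣≡0⇒i≡0 eq)))))
... | suc k = >⇒∤ (subst (_< q) eq (∣toℕ-difference∣<n x y)) (subst (q ∣ℕ_) eq (∣⇒∣ᵤ q∣y-x))

length-roots<length : ∀ {q} → Prime q → (p : List ℤ) → ¬ All (+ q ∣ₛ_) p →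
  (xs : List (Fin q)) → Unique xs → All (λ x → + q ∣ₛ horner p (+ toℕ x)) xs →
  length xs < length p
length-roots<length _ [] p≢0 _ _ _ = ⊥-elim (p≢0 [])
length-roots<length _ (c₀ ∷ p) _ [] _ _ = s≤s z≤n
length-roots<length {q} prime-q (c₀ ∷ p) p≢0 (x ∷ xs) (x∉xs ∷ xs!) (x-root ∷ xs-roots) =
  s≤s (subst (length xs <_) (length-linearQuotient a p)
        (length-roots<length prime-q E E≢0 xs xs! (All.zipWith root-of-E (x∉xs , xs-roots))))
  where
  a : ℤ
  a = + toℕ x
  E : List ℤ
  E = linearQuotient a p
  E≢0 : ¬ All (+ q ∣ₛ_) E
  E≢0 q∣E = p≢0 (∣-linearQuotient⇒∣-coefficients a c₀ p x-root q∣E)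
  root-of-E : ∀ {y} → x ≢ y × + q ∣ₛ horner (c₀ ∷ p) (+ toℕ y) → + q ∣ₛ horner E (+ toℕ y)
  root-of-E {y} (x≢y , y-root)
    with prime∣*⇒∣⊎∣ _ _ prime-q
           (subst (_ ∣ₛ_) (horner-linearQuotient a c₀ p (+ toℕ y)) (∣m∣n⇒∣m-n y-root x-root))
  ... | inj₁ q∣y-x  = ⊥-elim (≢⇒∤-toℕ-difference x≢y q∣y-x)
  ... | inj₂ q∣E[y] = q∣E[y]

length-filter+length-filter-∁ : ∀ {A : Set} {P : A → Set} (P? : Decidable P) xs →
  length (filter P? xs) + length (filter (∁? P?) xs) ≡ length xs
length-filter+length-filter-∁ P? []       = refl
length-filter+length-filter-∁ P? (x ∷ xs) with P? x
... | yes _ = cong suc (length-filter+length-filter-∁ P? xs)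
... | no  _ = trans (ℕₚ.+-suc _ _) (cong suc (length-filter+length-filter-∁ P? xs))

length-≤-covered : ∀ {A B : Set} {Good : A → Set} {R : A → B → Set} c →
  (∀ a → Decidable (R a)) →
  (∀ a → Good a → ∀ ys → Unique ys → All (R a) ys → length ys ≤ c) →
  ∀ as xs → Unique xs → All (λ x → Any (λ a → Good a × R a x) as) xs →
  length xs ≤ c * length as
length-≤-covered c R? fibre≤c [] [] _ _ = z≤n
length-≤-covered c R? fibre≤c [] (x ∷ xs) _ (() ∷ _)
length-≤-covered {Good = Good} {R} c R? fibre≤c (a ∷ as) xs xs! covered =
  -- Good a need not be decidable, but the goal is, so we may branch on Good a classically.
  decidable-stable (length xs ≤? c * suc (length as))
    (λ ¬goal → ¬¬-excluded-middle (¬goal ∘ cases))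
  where
  covered-by-as : ∀ {x} → ¬ R a x ⊎ ¬ Good a → Any (λ b → Good b × R b x) (a ∷ as) →
    Any (λ b → Good b × R b x) as
  covered-by-as (inj₁ ¬Rax)   (here (_ , Rax))     = ⊥-elim (¬Rax Rax)
  covered-by-as (inj₂ ¬Good-a) (here (Good-a , _)) = ⊥-elim (¬Good-a Good-a)
  covered-by-as _              (there w)           = w
  cases : Dec (Good a) → length xs ≤ c * suc (length as)
  cases (no ¬Good-a) = ℕₚ.≤-trans
    (length-≤-covered c R? fibre≤c as xs xs! (All.map (covered-by-as (inj₂ ¬Good-a)) covered))
    (ℕₚ.*-monoʳ-≤ c (ℕₚ.n≤1+n _))
  cases (yes Good-a) = begin
    length xs
      ≡⟨ length-filter+length-filter-∁ (R? a) xs ⟨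
    length (filter (R? a) xs) + length (filter (∁? (R? a)) xs)
      ≤⟨ ℕₚ.+-mono-≤ (fibre≤c a Good-a _ (Unique.filter⁺ (R? a) xs!) (all-filter (R? a) xs))
                      (length-≤-covered c R? fibre≤c as _ (Unique.filter⁺ (∁? (R? a)) xs!)
                        (All.zipWith (λ (¬Rax , w) → covered-by-as (inj₁ ¬Rax) w)
                          (all-filter (∁? (R? a)) xs , filter⁺ (∁? (R? a)) covered))) ⟩
    c + c * length as
      ≡⟨ ℕₚ.*-suc c (length as) ⟨
    c * suc (length as) ∎
    where open ℕₚ.≤-Reasoning

allSubsets : ∀ c → List (Subset c)
allSubsets zero    = [] ∷ []
allSubsets (suc c) = map (true ∷_) (allSubsets c) ++ map (false ∷_) (allSubsets c)

∈-allSubsets : ∀ {c} (S : Subset c) → S ∈ allSubsets c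
∈-allSubsets []                 = here refl
∈-allSubsets (true ∷ S)          = ∈-++⁺ˡ (∈-map⁺ (true ∷_) (∈-allSubsets S))
∈-allSubsets {suc c} (false ∷ S) =
  ∈-++⁺ʳ (map (true ∷_) (allSubsets c)) (∈-map⁺ (false ∷_) (∈-allSubsets S))

length-allSubsets : ∀ c → length (allSubsets c) ≡ 2 ^ c
length-allSubsets zero    = refl
length-allSubsets (suc c) = begin
  length (map (true ∷_) (allSubsets c) ++ map (false ∷_) (allSubsets c))
    ≡⟨ length-++ (map (true ∷_) (allSubsets c)) ⟩
  length (map (true ∷_) (allSubsets c)) + length (map (false ∷_) (allSubsets c))
    ≡⟨ cong₂ _+_ (length-map _ (allSubsets c)) (length-map _ (allSubsets c)) ⟩
  length (allSubsets c) + length (allSubsets c)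
    ≡⟨ cong (λ n → n + n) (length-allSubsets c) ⟩
  2 ^ c + 2 ^ c
    ≡⟨ cong (λ n → 2 ^ c + n) (ℕₚ.+-identityʳ (2 ^ c)) ⟨
  2 ^ suc c ∎
  where open ≡-Reasoning

length-cartesianProduct : ∀ {A B : Set} (xs : List A) (ys : List B) →
  length (cartesianProduct xs ys) ≡ length xs * length ys
length-cartesianProduct []       ys = refl
length-cartesianProduct (x ∷ xs) ys = begin
  length (map (x ,_) ys ++ cartesianProduct xs ys)         ≡⟨ length-++ (map (x ,_) ys) ⟩
  length (map (x ,_) ys) + length (cartesianProduct xs ys)
    ≡⟨ cong₂ _+_ (length-map _ ys) (length-cartesianProduct xs ys) ⟩
  length ys + length xs * length ys                          ∎
  where open ≡-Reasoning

roots-of-difference≤degree : ∀ {q} c → Prime q → (P Q : Poly) → ¬ PolyEq q c Q P →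
  (xs : List (Fin q)) → Unique xs →
  All (λ x → + q ∣ₛ eval c Q (+ toℕ x) - eval c P (+ toℕ x)) xs → length xs ≤ c
roots-of-difference≤degree {q} c prime-q P Q Q≢P xs xs! roots = s≤s⁻¹
  (subst (length xs <_) (length-applyUpTo D (suc c))
    (length-roots<length prime-q (applyUpTo D (suc c)) D≢0 xs xs! (All.map root-of-D roots)))
  where
  D : Poly
  D k = Q k - P k
  D≢0 : ¬ All (+ q ∣ₛ_) (applyUpTo D (suc c))
  D≢0 q∣D = Q≢P (λ k k≤c → ∣⇒∣ᵤ (applyUpTo⁻ D (suc c) q∣D k≤c))
  root-of-D : ∀ {x} → + q ∣ₛ eval c Q x - eval c P x → + q ∣ₛ horner (applyUpTo D (suc c)) x
  root-of-D {x} = subst (_ ∣ₛ_) (trans (eval-- c Q P x) (sumTo-horner (suc c) D x))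

corollary1 : (q c : ℕ) → Prime q → 5 ≤ q → 1 ≤ c →
    (I : List ℕ) → Unique I → All (λ m → m < half q ^ (c Data.Nat.+ 1)) I →
    (m : ℕ) → m ∈ I → (S : Subset c) →
    (xs : List (Fin q)) → Unique xs →
    All (IsMultiple q c I (derived (half q) m S)) xs →
    length xs ≤ c * 2 ^ c * length I
corollary1 q c prime-q _ _ I _ _ m _ S xs xs! multiple =
  subst (length xs ≤_) count
    (length-≤-covered c R? (λ a Q≢P → roots-of-difference≤degree c prime-q P (Q a) Q≢P)
      candidates xs xs! (All.map witness multiple))
  where
  P : Poly
  P = derived (half q) m S
  candidates : List (ℕ × Subset c)
  candidates = cartesianProduct I (allSubsets c)
  Q : ℕ × Subset c → Poly
  Q (m′ , S′) = derived (half q) m′ S′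
  R : ℕ × Subset c → Fin q → Set
  R a x = + q ∣ₛ eval c (Q a) (+ toℕ x) - eval c P (+ toℕ x)
  R? : ∀ a → Decidable (R a)
  R? a x = + q ∣? _
  witness : ∀ {x} → IsMultiple q c I P x → Any (λ a → ¬ PolyEq q c (Q a) P × R a x) candidates
  witness (m′ , S′ , m′∈I , Q≢P , Q[x]≡P[x]) =
    lose (∈-cartesianProduct⁺ m′∈I (∈-allSubsets S′)) (Q≢P , ∣ᵤ⇒∣ Q[x]≡P[x])
  count : c * length candidates ≡ c * 2 ^ c * length I
  count = begin
    c * length candidates                  ≡⟨ cong (c *_) (length-cartesianProduct I (allSubsets c)) ⟩
    c * (length I * length (allSubsets c)) ≡⟨ cong (λ n → c * (length I * n)) (length-allSubsets c) ⟩
    c * (length I * 2 ^ c)                 ≡⟨ cong (c *_) (ℕₚ.*-comm (length I) (2 ^ c)) ⟩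
    c * (2 ^ c * length I)                 ≡⟨ ℕₚ.*-assoc c (2 ^ c) (length I) ⟨
    c * 2 ^ c * length I                   ∎
    where open ≡-Reasoning
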